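{- Let $q$ be a prime power, let $n\ge 2$ be an integer and let $f:\mathbb{F}_q\to\mathbb{F}_q$ be $f(x)=x^n$. Let $q^*(n)$ be the largest divisor of $q-1$ that is relatively prime to $n$, and let $\hat r(n)$ be the least positive integer with $q^*(n)\mid n^{\hat r(n)}-1$. Then $f$ is a fixed point system if and only if $\hat r(n)=1$, i.e. if and only if $q^*(n)\mid (n-1)$.
   Context: $f$ is called a fixed point system if every cycle of $f$ has length $1$, i.e. every periodic point $x$ of $f$ (a point with $f^{\circ r}(x)=x$ for some $r\ge1$, $f^{\circ r}$ the $r$-th iterate) satisfies $f(x)=x$; equivalently every directed cycle of the state space digraph (vertices $\mathbb{F}_q$, edges $a\to f(a)$) has length 1. -}

module Defs where

open import Level using (0ℓ)
open import Data.Nat using (ℕ; zero; suc; _∸_; _^_; _≤_; _<_)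
open import Data.Nat.Divisibility using (_∣_)
open import Data.Nat.Coprimality using (Coprime)
open import Data.Nat.Primality using (Prime)
open import Data.Fin using (Fin)
open import Data.Product using (Σ; ∃; _×_)
open import Relation.Nullary using (¬_)
open import Relation.Binary.PropositionalEquality using (_≡_)
open import Algebra.Core using (Op₁; Op₂)
open import Algebra.Structures using (IsCommutativeRing)
open import Function.Bundles using (_⤖_)

IsPrimePower : ℕ → Set
IsPrimePower q = Σ ℕ λ p → Σ ℕ λ k → Prime p × 1 ≤ k × q ≡ p ^ k

record FiniteField (q : ℕ) : Set₁ where
  field
    Carrier : Set
    _+_ _*_ : Op₂ Carrier
    -_ : Op₁ Carrier
    0# 1# : Carrier
    isCommutativeRing : IsCommutativeRing {A = Carrier} _≡_ _+_ _*_ -_ 0# 1#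
    0≢1 : ¬ (0# ≡ 1#)
    inverse : ∀ x → ¬ (x ≡ 0#) → ∃ λ y → x * y ≡ 1#
    enumeration : Fin q ⤖ Carrier

module _ {q : ℕ} (F : FiniteField q) where
  open FiniteField F

  pow : Carrier → ℕ → Carrier
  pow x zero = 1#
  pow x (suc n) = x * pow x n

iter : {A : Set} → (A → A) → ℕ → A → A
iter f zero x = x
iter f (suc r) x = f (iter f r x)

FixedPointSystem : {A : Set} → (A → A) → Set
FixedPointSystem {A} f = ∀ (x : A) (r : ℕ) → 1 ≤ r → iter f r x ≡ x → f x ≡ x

IsQStar : ℕ → ℕ → ℕ → Set
IsQStar q n d = d ∣ (q ∸ 1) × Coprime d n × (∀ e → e ∣ (q ∸ 1) → Coprime e n → e ≤ d)

IsRHat : ℕ → ℕ → ℕ → Set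
IsRHat qs n r = 1 ≤ r × qs ∣ (n ^ r ∸ 1) × (∀ s → 1 ≤ s → qs ∣ (n ^ s ∸ 1) → r ≤ s)

module Submission where

-- Since fˢ(x) = x^(nˢ), a nonzero x is periodic iff x^(nˢ - 1) = 1 for some
-- s ≥ 1 and fixed iff x^(n - 1) = 1; 0 is always fixed. In place of the
-- cyclicity of 𝔽_q^× two facts suffice: Fermat (x^m = 1 for x ≠ 0, by
-- rearranging a product) and the bound "x^D = 1 has at most D solutions"
-- (a monic polynomial has at most degree-many roots, by the remainder theorem).
-- (⇐) For x ≠ 0 periodic, x^d = 1 with d = gcd(nˢ - 1, m); d is coprime to n
--     and divides m, so d ∣ q*(n) ∣ n - 1 by maximality, and x is fixed.
-- (⇒) With m = q*(n)·K and g = gcd(q*(n), n - 1), each y = x^K (x ≠ 0) has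
--     y^q*(n) = 1, so y is periodic, hence fixed, hence y^g = 1. The m nonzero
--     elements all solve x^(gK) = 1, so q*(n)·K ≤ g·K, i.e. q*(n) = g ∣ n - 1.
-- The file proves arithmetic lemmas, field algebra, Fermat's little theorem,
-- the two directions for the power map, and finally the theorem.

open import Defs
open import Data.Nat using (ℕ; _∸_; _≤_)
open import Data.Nat.Divisibility using (_∣_)
open import Data.Product using (_×_)
open import Relation.Binary.PropositionalEquality using (_≡_)
open import Function.Bundles using (_⇔_)

open import Level using (0ℓ)
open import Data.Nat as ℕ using (zero; suc; _^_; s≤s; z≤n; NonZero; >-nonZero; ≢-nonZero)
open import Data.Nat.Properties
  using (<⇒≤; suc-pred; ≤-antisym; m∸n+n≡m; m^n>0; *-comm; *-identityʳ; *-cancelʳ-≤; m*n≢0)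
open import Data.Nat.Divisibility
  using (divides; ∣-trans; ∣⇒≤; 0∣⇒≡0; ∣1⇒≡1; ∣m+n∣m⇒∣n; m∣m*n; n∣m*n)
open import Data.Nat.Coprimality using (Coprime; coprime-divisor)
open import Data.Nat.GCD using (gcd; gcd-GCD; gcd[m,n]∣m; gcd[m,n]∣n; gcd[m,n]≢0; module Bézout)
open import Data.Nat.LCM using (lcm; lcm-least; m∣lcm[m,n]; n∣lcm[m,n])
open import Data.Fin using (Fin; zero; suc; punchIn)
open import Data.Fin.Properties as Fin
  using (¬Fin0; 0≢1+n; suc-injective; punchIn-injective; punchInᵢ≢i)
open import Data.Fin.Permutation using (Permutation; permutation)
open import Data.List using (List; []; _∷_; length; replicate)
open import Data.List.Properties using (length-replicate)
open import Data.Product using (_,_; proj₁)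
open import Data.Sum using (inj₁)
open import Data.Empty using (⊥-elim)
open import Function using (_∘_)
open import Function.Bundles using (Equivalence; Inverse; mk⇔)
open import Function.Definitions using (Injective)
open import Function.Properties.Bijection using (⤖⇒↔)
open import Function.Properties.Equivalence using () renaming (trans to ⇔-trans; sym to ⇔-sym)
open import Algebra.Bundles using (CommutativeRing)
open import Algebra.Structures using (IsCommutativeRing)
open import Relation.Binary.PropositionalEquality
  using (_≢_; refl; sym; trans; cong; subst; module ≡-Reasoning)
open import Relation.Binary.Definitions using (DecidableEquality)
open import Relation.Nullary using (¬_; yes; no)
open import Relation.Nullary.Decidable using (map′)


∣-nonzero : ∀ {a b} → a ∣ b → b ≢ 0 → a ≢ 0
∣-nonzero a∣b b≢0 refl = b≢0 (0∣⇒≡0 a∣b)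

coprime-∣ : ∀ {a b n} → a ∣ b → Coprime b n → Coprime a n
coprime-∣ a∣b b-coprime (c∣a , c∣n) = b-coprime (∣-trans c∣a a∣b , c∣n)

coprime-* : ∀ {a b n} → Coprime a n → Coprime b n → Coprime (a ℕ.* b) n
coprime-* {a} {b} {n} a-coprime b-coprime {c} (c∣ab , c∣n) =
  b-coprime (coprime-divisor c-coprime-a c∣ab , c∣n)
  where
    c-coprime-a : Coprime c a
    c-coprime-a (e∣c , e∣a) = a-coprime (e∣a , ∣-trans e∣c c∣n)

-- For n ≥ 1 and s ≥ 1, every divisor of nˢ - 1 is coprime to n,
-- since a common divisor divides both nˢ - 1 and nˢ.
coprime-power-pred : ∀ {d n s} → 1 ≤ n → 1 ≤ s → d ∣ n ^ s ∸ 1 → Coprime d n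
coprime-power-pred {d} {n} {suc s} 1≤n _ d∣nˢ⁻¹ {c} (c∣d , c∣n) =
  ∣1⇒≡1 (∣m+n∣m⇒∣n c∣nˢ (∣-trans c∣d d∣nˢ⁻¹))
  where
    c∣nˢ : c ∣ (n ^ suc s ∸ 1) ℕ.+ 1
    c∣nˢ = subst (c ∣_) (sym (m∸n+n≡m (m^n>0 n ⦃ >-nonZero 1≤n ⦄ (suc s))))
                 (∣-trans c∣n (m∣m*n (n ^ s)))

-- Maximality of q*(n) upgrades to divisibility: every divisor d of q - 1
-- coprime to n divides q*(n), because lcm(d, q*(n)) is again such a divisor.
∣-qstar : ∀ {q n qs d} → q ∸ 1 ≢ 0 → IsQStar q n qs →
          d ∣ q ∸ 1 → Coprime d n → d ∣ qs
∣-qstar {q} {n} {qs} {d} q-1≢0 (qs∣q-1 , qs-coprime , maximal) d∣q-1 d-coprime =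
  subst (d ∣_) lcm≡qs (m∣lcm[m,n] d qs)
  where
    lcm∣q-1 : lcm d qs ∣ q ∸ 1
    lcm∣q-1 = lcm-least d∣q-1 qs∣q-1
    lcm-coprime : Coprime (lcm d qs) n
    lcm-coprime = coprime-∣ (lcm-least (m∣m*n {d} qs) (n∣m*n d {qs})) (coprime-* d-coprime qs-coprime)
    lcm≡qs : lcm d qs ≡ qs
    lcm≡qs = ≤-antisym (maximal (lcm d qs) lcm∣q-1 lcm-coprime)
                       (∣⇒≤ ⦃ ≢-nonZero (∣-nonzero lcm∣q-1 q-1≢0) ⦄ (n∣lcm[m,n] d qs))

rhat≡1⇔ : ∀ {qs n r} → IsRHat qs n r → (r ≡ 1 ⇔ qs ∣ n ∸ 1)
rhat≡1⇔ {qs} {n} (1≤r , qs∣nʳ-1 , minimal) = mk⇔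
  (λ { refl → subst (λ k → qs ∣ k ∸ 1) (*-identityʳ n) qs∣nʳ-1 })
  (λ qs∣n-1 → ≤-antisym (minimal 1 (s≤s z≤n) (qs∣n¹-1 qs∣n-1)) 1≤r)
  where
    qs∣n¹-1 : qs ∣ n ∸ 1 → qs ∣ n ^ 1 ∸ 1
    qs∣n¹-1 = subst (λ k → qs ∣ k ∸ 1) (sym (*-identityʳ n))

module FieldAlgebra {q : ℕ} (F : FiniteField q) where
  open FiniteField F
  open IsCommutativeRing isCommutativeRing
    using ( +-identityˡ; +-identityʳ; *-assoc; *-identityˡ; distribʳ; zeroˡ; zeroʳ
          ; -‿inverseˡ; -‿inverseʳ)
    renaming (*-comm to *-comm′; *-identityʳ to *-identityʳ′)

  commutativeRing : CommutativeRing 0ℓ 0ℓ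
  commutativeRing = record { isCommutativeRing = isCommutativeRing }

  open import Algebra.Properties.Ring (CommutativeRing.ring commutativeRing)
    using (x∙y⁻¹≈ε⇒x≈y)
  open import Algebra.Solver.Ring.NaturalCoefficients.Default
    (CommutativeRing.commutativeSemiring commutativeRing) using (solve; _:+_; _:*_; _:=_)
  open import Algebra.Properties.CommutativeMonoid.Sum (CommutativeRing.*-commutativeMonoid commutativeRing)
    using () renaming (sum to product)
  open ≡-Reasoning

  pow-+ : ∀ x a b → pow F x (a ℕ.+ b) ≡ pow F x a * pow F x b
  pow-+ x zero    b = sym (*-identityˡ _)
  pow-+ x (suc a) b = trans (cong (x *_) (pow-+ x a b)) (sym (*-assoc _ _ _))

  pow-* : ∀ x a k → pow F x (k ℕ.* a) ≡ pow F (pow F x a) k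
  pow-* x a zero    = refl
  pow-* x a (suc k) = trans (pow-+ x a (k ℕ.* a)) (cong (pow F x a *_) (pow-* x a k))

  pow-1# : ∀ k → pow F 1# k ≡ 1#
  pow-1# zero    = refl
  pow-1# (suc k) = trans (*-identityˡ _) (pow-1# k)

  *-cancelˡ : ∀ {x} y z → x ≢ 0# → x * y ≡ x * z → y ≡ z
  *-cancelˡ {x} y z x≢0 xy≡xz with inverse x x≢0
  ... | x⁻¹ , xx⁻¹≡1 = begin
    y                ≡⟨ sym (*-identityˡ y) ⟩
    1# * y           ≡⟨ cong (_* y) x⁻¹x≡1 ⟩
    (x⁻¹ * x) * y    ≡⟨ *-assoc x⁻¹ x y ⟩
    x⁻¹ * (x * y)    ≡⟨ cong (x⁻¹ *_) xy≡xz ⟩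
    x⁻¹ * (x * z)    ≡⟨ sym (*-assoc x⁻¹ x z) ⟩
    (x⁻¹ * x) * z    ≡⟨ cong (_* z) (sym x⁻¹x≡1) ⟩
    1# * z           ≡⟨ *-identityˡ z ⟩
    z                ∎
    where
      x⁻¹x≡1 : 1# ≡ x⁻¹ * x
      x⁻¹x≡1 = sym (trans (*-comm′ x⁻¹ x) xx⁻¹≡1)

  *-cancelˡ-1# : ∀ {x} y → x ≢ 0# → x * y ≡ x → y ≡ 1#
  *-cancelˡ-1# {x} y x≢0 xy≡x = *-cancelˡ y 1# x≢0 (trans xy≡x (sym (*-identityʳ′ x)))

  *-nonzero : ∀ {x y} → x ≢ 0# → y ≢ 0# → x * y ≢ 0#
  *-nonzero {x} {y} x≢0 y≢0 xy≡0 = y≢0 (*-cancelˡ y 0# x≢0 (trans xy≡0 (sym (zeroʳ x))))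

  pow-nonzero : ∀ {x} k → x ≢ 0# → pow F x k ≢ 0#
  pow-nonzero zero    x≢0 1≡0 = 0≢1 (sym 1≡0)
  pow-nonzero (suc k) x≢0     = *-nonzero x≢0 (pow-nonzero k x≢0)

  product-scale : ∀ {k} x (a : Fin k → Carrier) → product (λ i → x * a i) ≡ pow F x k * product a
  product-scale {zero}  x a = sym (*-identityˡ 1#)
  product-scale {suc k} x a = trans (cong ((x * a zero) *_) (product-scale x (a ∘ suc)))
    (solve 4 (λ x a₀ xᵏ p → (x :* a₀) :* (xᵏ :* p) := (x :* xᵏ) :* (a₀ :* p))
             refl x (a zero) (pow F x k) (product (a ∘ suc)))

  product-nonzero : ∀ {k} (a : Fin k → Carrier) → (∀ i → a i ≢ 0#) → product a ≢ 0#
  product-nonzero {zero}  a _      1≡0 = 0≢1 (sym 1≡0)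
  product-nonzero {suc k} a a≢0 = *-nonzero (a≢0 zero) (product-nonzero (a ∘ suc) (a≢0 ∘ suc))

  pow≡1-∣ : ∀ x {a c} → a ∣ c → pow F x a ≡ 1# → pow F x c ≡ 1#
  pow≡1-∣ x {a} (divides k refl) xᵃ≡1 =
    trans (pow-* x a k) (trans (cong (λ y → pow F y k) xᵃ≡1) (pow-1# k))

  pow≡1-+ : ∀ x {d e} → pow F x (d ℕ.+ e) ≡ 1# → pow F x e ≡ 1# → pow F x d ≡ 1#
  pow≡1-+ x {d} {e} xᵈ⁺ᵉ≡1 xᵉ≡1 = begin
    pow F x d                ≡⟨ sym (*-identityʳ′ _) ⟩
    pow F x d * 1#           ≡⟨ cong (pow F x d *_) (sym xᵉ≡1) ⟩
    pow F x d * pow F x e    ≡⟨ sym (pow-+ x d e) ⟩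
    pow F x (d ℕ.+ e)        ≡⟨ xᵈ⁺ᵉ≡1 ⟩
    1#                       ∎

  pow≡1-gcd : ∀ x {a b} → pow F x a ≡ 1# → pow F x b ≡ 1# → pow F x (gcd a b) ≡ 1#
  pow≡1-gcd x {a} {b} xᵃ≡1 xᵇ≡1 with Bézout.identity (gcd-GCD a b)
  ... | Bézout.+- s t d+tb≡sa =
    pow≡1-+ x {gcd a b} {t ℕ.* b}
      (trans (cong (pow F x) d+tb≡sa) (pow≡1-∣ x (n∣m*n s) xᵃ≡1))
      (pow≡1-∣ x (n∣m*n t) xᵇ≡1)
  ... | Bézout.-+ s t d+sa≡tb =
    pow≡1-+ x {gcd a b} {s ℕ.* a}
      (trans (cong (pow F x) d+sa≡tb) (pow≡1-∣ x (n∣m*n t) xᵇ≡1))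
      (pow≡1-∣ x (n∣m*n s) xᵃ≡1)

  pow≡self⇔ : ∀ {x} N → 1 ≤ N → x ≢ 0# → (pow F x N ≡ x ⇔ pow F x (N ∸ 1) ≡ 1#)
  pow≡self⇔ {x} (suc N) _ x≢0 =
    mk⇔ (*-cancelˡ-1# _ x≢0) (λ xᴺ≡1 → trans (cong (x *_) xᴺ≡1) (*-identityʳ′ x))

  iter-pow : ∀ n r x → iter (λ y → pow F y n) r x ≡ pow F x (n ^ r)
  iter-pow n zero    x = sym (*-identityʳ′ x)
  iter-pow n (suc r) x =
    trans (cong (λ y → pow F y n) (iter-pow n r x)) (sym (pow-* x (n ^ r) n))

  periodic⇔ : ∀ {n} r {x} → 1 ≤ n → x ≢ 0# →
              (iter (λ y → pow F y n) r x ≡ x ⇔ pow F x (n ^ r ∸ 1) ≡ 1#)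
  periodic⇔ {n} r {x} 1≤n x≢0 rewrite iter-pow n r x =
    pow≡self⇔ (n ^ r) (m^n>0 n ⦃ >-nonZero 1≤n ⦄ r) x≢0

  -- A monic polynomial c₀ + c₁x + … + c_{k-1}x^{k-1} + xᵏ is represented by
  -- the list of its lower coefficients; its degree is the length of the list.
  eval : List Carrier → Carrier → Carrier
  eval []       x = 1#
  eval (c ∷ cs) x = c + (x * eval cs x)

  -- Synthetic division of the monic polynomial c ∷ cs by (x - a).
  quotient : Carrier → Carrier → List Carrier → List Carrier
  quotient a c []       = []
  quotient a c (d ∷ ds) = eval (d ∷ ds) a ∷ quotient a d ds

  quotient-length : ∀ a c cs → length (quotient a c cs) ≡ length cs
  quotient-length a c []       = refl
  quotient-length a c (d ∷ ds) = cong suc (quotient-length a d ds)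

  -- Remainder theorem p(x) = (x - a)·Q(x) + p(a), stated without subtraction.
  remainder : ∀ a c cs x →
    eval (c ∷ cs) x + (a * eval (quotient a c cs) x)
      ≡ (x * eval (quotient a c cs) x) + eval (c ∷ cs) a
  remainder a c [] x =
    solve 4 (λ c x a u → (c :+ x :* u) :+ a :* u := x :* u :+ (c :+ a :* u)) refl c x a 1#
  remainder a c (d ∷ ds) x = begin
    (c + (x * P)) + (a * (E + (x * Q)))  ≡⟨ regroup₁ ⟩
    (c + (a * E)) + (x * (P + (a * Q)))  ≡⟨ cong (λ t → (c + (a * E)) + (x * t)) IH ⟩
    (c + (a * E)) + (x * ((x * Q) + E))  ≡⟨ regroup₂ ⟩
    (x * (E + (x * Q))) + (c + (a * E))  ∎
    where
      P = eval (d ∷ ds) x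
      E = eval (d ∷ ds) a
      Q = eval (quotient a d ds) x
      IH : P + (a * Q) ≡ (x * Q) + E
      IH = remainder a d ds x
      regroup₁ : (c + (x * P)) + (a * (E + (x * Q))) ≡ (c + (a * E)) + (x * (P + (a * Q)))
      regroup₁ = solve 6 (λ c x a P E Q →
        (c :+ x :* P) :+ a :* (E :+ x :* Q) := (c :+ a :* E) :+ x :* (P :+ a :* Q)) refl c x a P E Q
      regroup₂ : (c + (a * E)) + (x * ((x * Q) + E)) ≡ (x * (E + (x * Q))) + (c + (a * E))
      regroup₂ = solve 5 (λ c x a E Q →
        (c :+ a :* E) :+ x :* (x :* Q :+ E) := x :* (E :+ x :* Q) :+ (c :+ a :* E)) refl c x a E Q

  *-cancelʳ-≢ : ∀ {x a} y → x ≢ a → x * y ≡ a * y → y ≡ 0#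
  *-cancelʳ-≢ {x} {a} y x≢a xy≡ay = *-cancelˡ y 0# x-a≢0 (begin
    (x + (- a)) * y          ≡⟨ distribʳ y x (- a) ⟩
    (x * y) + ((- a) * y)    ≡⟨ cong (_+ ((- a) * y)) xy≡ay ⟩
    (a * y) + ((- a) * y)    ≡⟨ sym (distribʳ y a (- a)) ⟩
    (a + (- a)) * y          ≡⟨ cong (_* y) (-‿inverseʳ a) ⟩
    0# * y                   ≡⟨ zeroˡ y ⟩
    0#                       ≡⟨ sym (zeroʳ _) ⟩
    (x + (- a)) * 0#         ∎)
    where
      x-a≢0 : x + (- a) ≢ 0#
      x-a≢0 = x≢a ∘ x∙y⁻¹≈ε⇒x≈y x a

  quotient-root : ∀ a c cs {x} → x ≢ a → eval (c ∷ cs) x ≡ 0# → eval (c ∷ cs) a ≡ 0# →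
                  eval (quotient a c cs) x ≡ 0#
  quotient-root a c cs {x} x≢a px≡0 pa≡0 = *-cancelʳ-≢ Q x≢a (begin
    x * Q                      ≡⟨ sym (+-identityʳ _) ⟩
    (x * Q) + 0#               ≡⟨ cong ((x * Q) +_) (sym pa≡0) ⟩
    (x * Q) + eval (c ∷ cs) a  ≡⟨ sym (remainder a c cs x) ⟩
    eval (c ∷ cs) x + (a * Q)  ≡⟨ cong (_+ (a * Q)) px≡0 ⟩
    0# + (a * Q)               ≡⟨ +-identityˡ _ ⟩
    a * Q                      ∎)
    where Q = eval (quotient a c cs) x

  roots≤degree : ∀ p {k} (root : Fin k → Carrier) → Injective _≡_ _≡_ root →
                 (∀ i → eval p (root i) ≡ 0#) → k ≤ length p
  roots≤degree p        {zero}  root injective isRoot = z≤n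
  roots≤degree []       {suc k} root injective isRoot = ⊥-elim (0≢1 (sym (isRoot zero)))
  roots≤degree (c ∷ cs) {suc k} root injective isRoot =
    s≤s (subst (k ≤_) (quotient-length a c cs)
          (roots≤degree (quotient a c cs) (root ∘ suc) (suc-injective ∘ injective) isQuotientRoot))
    where
      a = root zero
      isQuotientRoot : ∀ i → eval (quotient a c cs) (root (suc i)) ≡ 0#
      isQuotientRoot i =
        quotient-root a c cs (λ eq → 0≢1+n (sym (injective eq))) (isRoot (suc i)) (isRoot zero)

  -- In particular xᴰ = 1 (D ≥ 1) has at most D solutions: they are roots of
  -- the monic polynomial xᴰ - 1.
  roots-of-unity≤ : ∀ D ⦃ _ : NonZero D ⦄ {k} (root : Fin k → Carrier) →
                    Injective _≡_ _≡_ root → (∀ i → pow F (root i) D ≡ 1#) → k ≤ D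
  roots-of-unity≤ (suc D) {k} root injective isRoot =
    subst (k ≤_) (cong suc (length-replicate D))
      (roots≤degree ((- 1#) ∷ replicate D 0#) root injective isRoot′)
    where
      eval-monomial : ∀ j x → eval (replicate j 0#) x ≡ pow F x j
      eval-monomial zero    x = refl
      eval-monomial (suc j) x = trans (+-identityˡ _) (cong (x *_) (eval-monomial j x))
      isRoot′ : ∀ i → eval ((- 1#) ∷ replicate D 0#) (root i) ≡ 0#
      isRoot′ i = begin
        (- 1#) + (root i * eval (replicate D 0#) (root i))
          ≡⟨ cong (λ t → (- 1#) + (root i * t)) (eval-monomial D (root i)) ⟩
        (- 1#) + pow F (root i) (suc D)  ≡⟨ cong ((- 1#) +_) (isRoot i) ⟩
        (- 1#) + 1#                      ≡⟨ -‿inverseˡ 1# ⟩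
        0#                               ∎

no-field-of-size-0 : ¬ FiniteField 0
no-field-of-size-0 F = ¬Fin0 (Inverse.from (⤖⇒↔ (FiniteField.enumeration F)) (FiniteField.0# F))

no-field-of-size-1 : ¬ FiniteField 1
no-field-of-size-1 F = 0≢1 (begin
  0#             ≡⟨ sym (strictlyInverseˡ 0#) ⟩
  to (from 0#)   ≡⟨ cong to (fin1-unique (from 0#) (from 1#)) ⟩
  to (from 1#)   ≡⟨ strictlyInverseˡ 1# ⟩
  1#             ∎)
  where
    open FiniteField F
    open Inverse (⤖⇒↔ enumeration) using (to; from; strictlyInverseˡ)
    open ≡-Reasoning
    fin1-unique : (i j : Fin 1) → i ≡ j
    fin1-unique zero zero = refl

module FiniteFieldFacts {m : ℕ} (F : FiniteField (suc m)) where
  open FiniteField F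
  open IsCommutativeRing isCommutativeRing
    using (*-assoc; *-identityˡ; zeroʳ) renaming (*-comm to *-comm′)
  open FieldAlgebra F
  open Inverse (⤖⇒↔ enumeration) using (to; from; strictlyInverseˡ; strictlyInverseʳ)
  open import Algebra.Properties.CommutativeMonoid.Sum (CommutativeRing.*-commutativeMonoid commutativeRing)
    using () renaming (sum to product; sum-remove to product-remove; sum-permute to product-permute;
                       sum-cong-≗ to product-cong)
  open ≡-Reasoning

  to-injective : Injective _≡_ _≡_ to
  to-injective {i} {j} eq =
    trans (sym (strictlyInverseʳ i)) (trans (cong from eq) (strictlyInverseʳ j))

  _≟_ : DecidableEquality Carrier
  x ≟ y = map′ (λ eq → trans (sym (strictlyInverseˡ x)) (trans (cong to eq) (strictlyInverseˡ y)))
               (cong from) (from x Fin.≟ from y)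

  -- The m nonzero elements, listed by skipping the index of 0#.
  zeroIndex : Fin (suc m)
  zeroIndex = from 0#

  nonzero : Fin m → Carrier
  nonzero i = to (punchIn zeroIndex i)

  nonzero-≢0 : ∀ i → nonzero i ≢ 0#
  nonzero-≢0 i eq = punchInᵢ≢i zeroIndex i (trans (sym (strictlyInverseʳ _)) (cong from eq))

  nonzero-injective : Injective _≡_ _≡_ nonzero
  nonzero-injective eq = punchIn-injective zeroIndex _ _ (to-injective eq)

  product-skip-zero : (φ : Carrier → Carrier) → φ 0# ≡ 1# →
                      product (φ ∘ to) ≡ product (φ ∘ nonzero)
  product-skip-zero φ φ0≡1 = begin
    product (φ ∘ to)                 ≡⟨ product-remove {i = zeroIndex} (φ ∘ to) ⟩
    φ (to zeroIndex) * ∏nonzero      ≡⟨ cong (λ y → φ y * ∏nonzero) (strictlyInverseˡ 0#) ⟩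
    φ 0# * ∏nonzero                  ≡⟨ cong (_* ∏nonzero) φ0≡1 ⟩
    1# * ∏nonzero                    ≡⟨ *-identityˡ _ ⟩
    ∏nonzero                         ∎
    where ∏nonzero = product (φ ∘ nonzero)

  -- For x ≠ 0 the map y ↦ x·y permutes the field, so it does not change a
  -- product taken over all elements.
  product-scaling-invariant : ∀ {x} (φ : Carrier → Carrier) → x ≢ 0# →
                              product (φ ∘ to) ≡ product (λ i → φ (x * to i))
  product-scaling-invariant {x} φ x≢0 with inverse x x≢0
  ... | x⁻¹ , xx⁻¹≡1 =
    trans (product-permute (φ ∘ to) scaling)
          (product-cong (λ i → cong φ (strictlyInverseˡ (x * to i))))
    where
      rescale : Carrier → Fin (suc m) → Fin (suc m)
      rescale u i = from (u * to i)
      rescale-inverse : ∀ {u v} → u * v ≡ 1# → ∀ i → rescale u (rescale v i) ≡ i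
      rescale-inverse {u} {v} uv≡1 i = begin
        from (u * to (from (v * to i)))   ≡⟨ cong (from ∘ (u *_)) (strictlyInverseˡ (v * to i)) ⟩
        from (u * (v * to i))             ≡⟨ cong from (sym (*-assoc u v (to i))) ⟩
        from ((u * v) * to i)             ≡⟨ cong (λ y → from (y * to i)) uv≡1 ⟩
        from (1# * to i)                  ≡⟨ cong from (*-identityˡ (to i)) ⟩
        from (to i)                       ≡⟨ strictlyInverseʳ i ⟩
        i                                 ∎
      scaling : Permutation (suc m) (suc m)
      scaling = permutation (rescale x) (rescale x⁻¹)
                  (rescale-inverse xx⁻¹≡1) (rescale-inverse (trans (*-comm′ x⁻¹ x) xx⁻¹≡1))

  unitPart : Carrier → Carrier
  unitPart y with y ≟ 0#
  ... | yes _ = 1#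
  ... | no  _ = y

  unitPart-0# : unitPart 0# ≡ 1#
  unitPart-0# with 0# ≟ 0#
  ... | yes _   = refl
  ... | no  0≢0 = ⊥-elim (0≢0 refl)

  unitPart-≢0 : ∀ {y} → y ≢ 0# → unitPart y ≡ y
  unitPart-≢0 {y} y≢0 with y ≟ 0#
  ... | yes y≡0 = ⊥-elim (y≢0 y≡0)
  ... | no  _   = refl

  -- Fermat: with A the product of all nonzero elements, scaling by x gives
  -- A = x^m · A, and A ≠ 0.
  fermat : ∀ {x} → x ≢ 0# → pow F x m ≡ 1#
  fermat {x} x≢0 = *-cancelˡ-1# (pow F x m) (product-nonzero nonzero nonzero-≢0) (begin
    A * pow F x m                             ≡⟨ *-comm′ A (pow F x m) ⟩
    pow F x m * A                             ≡⟨ sym (product-scale x nonzero) ⟩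
    product (λ i → x * nonzero i)             ≡⟨ product-cong (sym ∘ unitPart-≢0 ∘ x·nonzero-≢0) ⟩
    product (λ i → unitPart (x * nonzero i))  ≡⟨ sym (product-skip-zero (unitPart ∘ (x *_)) unitPart-x0) ⟩
    product (λ i → unitPart (x * to i))       ≡⟨ sym (product-scaling-invariant unitPart x≢0) ⟩
    product (unitPart ∘ to)                   ≡⟨ product-skip-zero unitPart unitPart-0# ⟩
    product (unitPart ∘ nonzero)              ≡⟨ product-cong (unitPart-≢0 ∘ nonzero-≢0) ⟩
    A                                         ∎)
    where
      A = product nonzero
      x·nonzero-≢0 : ∀ i → x * nonzero i ≢ 0#
      x·nonzero-≢0 i = *-nonzero x≢0 (nonzero-≢0 i)
      unitPart-x0 : unitPart (x * 0#) ≡ 1#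
      unitPart-x0 = trans (cong unitPart (zeroʳ x)) unitPart-0#

module PowerMap {m : ℕ} (F : FiniteField (suc m)) (m≢0 : m ≢ 0) {n : ℕ} (1≤n : 1 ≤ n) where
  open FiniteField F
  open IsCommutativeRing isCommutativeRing using (zeroˡ)
  open FieldAlgebra F
  open FiniteFieldFacts F

  f : Carrier → Carrier
  f x = pow F x n

  f-0# : f 0# ≡ 0#
  f-0# = trans (cong (pow F 0#) (sym (suc-pred n ⦃ >-nonZero 1≤n ⦄))) (zeroˡ _)

  -- (⇐) If q*(n) ∣ n - 1, a nonzero periodic x has x^d = 1 for
  -- d = gcd(nˢ - 1, m), and d ∣ q*(n) ∣ n - 1, so x is fixed.
  fixed-point-system-if : ∀ {qs} → IsQStar (suc m) n qs → qs ∣ n ∸ 1 → FixedPointSystem f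
  fixed-point-system-if {qs} isQStar qs∣n-1 x s 1≤s periodic with x ≟ 0#
  ... | yes refl = f-0#
  ... | no  x≢0  =
    Equivalence.from (pow≡self⇔ n 1≤n x≢0) (pow≡1-∣ x (∣-trans d∣qs qs∣n-1) xᵈ≡1)
    where
      N = n ^ s ∸ 1
      d = gcd N m
      xᵈ≡1 : pow F x d ≡ 1#
      xᵈ≡1 = pow≡1-gcd x {N} {m} (Equivalence.to (periodic⇔ s 1≤n x≢0) periodic) (fermat x≢0)
      d∣qs : d ∣ qs
      d-coprime : Coprime d n
      d-coprime = coprime-power-pred {n = n} {s} 1≤n 1≤s (gcd[m,n]∣m N m)
      d∣qs = ∣-qstar {suc m} m≢0 isQStar (gcd[m,n]∣n N m) d-coprime

  -- Core of (⇒): if f has only fixed points as periodic points and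
  -- m = d·K with d ∣ nˢ - 1 (s ≥ 1), then every nonzero x satisfies
  -- x^(gcd(d, n-1)·K) = 1. Indeed y = x^K has y^d = x^m = 1 (Fermat), so y
  -- is periodic, hence fixed, hence y^(n-1) = 1 as well.
  fixed-point-system⇒root-of-unity : ∀ {d K s} → FixedPointSystem f → m ≡ d ℕ.* K →
    1 ≤ s → d ∣ n ^ s ∸ 1 → ∀ {x} → x ≢ 0# → pow F x (gcd d (n ∸ 1) ℕ.* K) ≡ 1#
  fixed-point-system⇒root-of-unity {d} {K} {s} fps m≡dK 1≤s d∣nˢ-1 {x} x≢0 =
    trans (pow-* x K (gcd d (n ∸ 1))) (pow≡1-gcd y {d} {n ∸ 1} yᵈ≡1 yⁿ⁻¹≡1)
    where
      y = pow F x K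
      y≢0 : y ≢ 0#
      y≢0 = pow-nonzero K x≢0
      yᵈ≡1 : pow F y d ≡ 1#
      yᵈ≡1 = trans (sym (pow-* x K d)) (trans (cong (pow F x) (sym m≡dK)) (fermat x≢0))
      y-periodic : iter f s y ≡ y
      y-periodic = Equivalence.from (periodic⇔ s 1≤n y≢0) (pow≡1-∣ y d∣nˢ-1 yᵈ≡1)
      yⁿ⁻¹≡1 : pow F y (n ∸ 1) ≡ 1#
      yⁿ⁻¹≡1 = Equivalence.to (pow≡self⇔ n 1≤n y≢0) (fps y s 1≤s y-periodic)

  -- (⇒) If f has only fixed points as periodic points, then every divisor d
  -- of m with d ∣ nˢ - 1 (s ≥ 1) divides n - 1: writing m = d·K and
  -- g = gcd(d, n - 1), all m nonzero elements solve x^(g·K) = 1, so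
  -- d·K ≤ g·K by the root bound, and g ∣ d forces g = d.
  fixed-point-system-only-if : ∀ {d s} → d ∣ m → 1 ≤ s → d ∣ n ^ s ∸ 1 →
                               FixedPointSystem f → d ∣ n ∸ 1
  fixed-point-system-only-if {d} d∣m@(divides K m≡Kd) 1≤s d∣nˢ-1 fps =
    subst (_∣ n ∸ 1) g≡d (gcd[m,n]∣n d (n ∸ 1))
    where
      g = gcd d (n ∸ 1)
      d≢0 : d ≢ 0
      d≢0 = ∣-nonzero d∣m m≢0
      K≢0 : K ≢ 0
      K≢0 refl = m≢0 m≡Kd
      instance
        g-nonZero : NonZero g
        g-nonZero = ≢-nonZero (gcd[m,n]≢0 d (n ∸ 1) (inj₁ d≢0))
        K-nonZero : NonZero K
        K-nonZero = ≢-nonZero K≢0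
      m≡dK : m ≡ d ℕ.* K
      m≡dK = trans m≡Kd (*-comm K d)
      dK≤gK : d ℕ.* K ≤ g ℕ.* K
      dK≤gK = subst (_≤ g ℕ.* K) m≡dK
        (roots-of-unity≤ (g ℕ.* K) ⦃ m*n≢0 g K ⦄ nonzero nonzero-injective
          (fixed-point-system⇒root-of-unity fps m≡dK 1≤s d∣nˢ-1 ∘ nonzero-≢0))
      g≡d : g ≡ d
      g≡d = ≤-antisym (∣⇒≤ ⦃ ≢-nonZero d≢0 ⦄ (gcd[m,n]∣m d (n ∸ 1)))
                      (*-cancelʳ-≤ d g K dK≤gK)

proposition2p17 : (q : ℕ) → IsPrimePower q → (F : FiniteField q) → (n : ℕ) → 2 ≤ n →
    (qs : ℕ) → IsQStar q n qs → (r : ℕ) → IsRHat qs n r →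
    (FixedPointSystem (λ x → pow F x n) ⇔ r ≡ 1)
      × (FixedPointSystem (λ x → pow F x n) ⇔ qs ∣ (n ∸ 1))
proposition2p17 zero          _ F = ⊥-elim (no-field-of-size-0 F)
proposition2p17 (suc zero)    _ F = ⊥-elim (no-field-of-size-1 F)
proposition2p17 (suc (suc m)) _ F n 2≤n qs isQStar r isRHat@(1≤r , qs∣nʳ-1 , _) =
  ⇔-trans fps⇔qs∣n-1 (⇔-sym (rhat≡1⇔ isRHat)) , fps⇔qs∣n-1
  where
    open PowerMap F (λ ()) (<⇒≤ 2≤n)
    fps⇔qs∣n-1 : FixedPointSystem f ⇔ qs ∣ n ∸ 1
    fps⇔qs∣n-1 = mk⇔ (fixed-point-system-only-if (proj₁ isQStar) 1≤r qs∣nʳ-1)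
                     (fixed-point-system-if isQStar)
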